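{- Let $b\ge2$, $s\ge1$ and $u\ge0$ be integers and let $\mathbf{e}=(e_1,\dots,e_s)\in\mathbb{N}^s$. Then any $(u,\mathbf{e},s)$-sequence in base $b$ is a $(\lceil u/g\rceil,s)$-sequence in base $b^g$, where $g$ is the least common multiple of $e_1,\dots,e_s$.
   Context: $\mathbb{N}$ denotes the positive integers, $\lambda_s$ Lebesgue measure. An elementary interval in base $b$ is $J=\prod_{i=1}^s[a_ib^{ -d_i},(a_i+1)b^{ -d_i})$ with integers $d_i\ge0$, $0\le a_i<b^{d_i}$. For integers $0\le u\le m$ and $\mathbf{e}=(e_1,\dots,e_s)\in\mathbb{N}^s$, a set of $b^m$ points in $[0,1)^s$ is a $(u,m,\mathbf{e},s)$-net in base $b$ if every elementary interval $J$ in base $b$ with $\lambda_s(J)\ge b^{u-m}$ and $e_i\mid d_i$ for all $i$ contains exactly $b^m\lambda_s(J)$ of the points. For $\mathbf{x}\in[0,1]^s$, $[\mathbf{x}]_{b,m}$ denotes the coordinatewise $m$-digit truncation of $\mathbf{x}$ in base $b$. For an integer $u\ge0$, a sequence $\mathbf{x}_0,\mathbf{x}_1,\dots$ in $[0,1]^s$ is a $(u,\mathbf{e},s)$-sequence in base $b$ if for all integers $k\ge0$ and $m>u$ the points $[\mathbf{x}_n]_{b,m}$ with $kb^m\le n<(k+1)b^m$ form a $(u,m,\mathbf{e},s)$-net in base $b$. A $(t,s)$-sequence in base $b$ is a $(t,\mathbf{1},s)$-sequence in base $b$ with $\mathbf{1}=(1,\dots,1)$. -}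

module Defs where

open import Data.Nat using (ℕ; zero; suc; _+_; _*_; _∸_; _^_; _≤_; _<_; _<ᵇ_; pred)
open import Data.Nat.DivMod using (_/_)
open import Data.Nat.LCM using (lcm)
open import Data.Nat.Divisibility using (_∣_)
open import Data.Nat.Properties using (_≟_)
open import Data.Fin using (Fin; zero; suc)
open import Data.Fin.Properties using (all?)
open import Data.Bool using (if_then_else_)
open import Data.List using (List; length; filter; map; upTo)
open import Data.Product using (_×_)
open import Relation.Binary.PropositionalEquality using (_≡_)

-- A real coordinate in [0,1] is represented by a base-B digit expansion
-- x = Σ_{j≥0} x(j) B^{-(j+1)}, digits given as naturals (validity x j < B
-- is part of the sequence predicate below).
Digits : Set
Digits = ℕ → ℕ

PointSeq : ℕ → Set
PointSeq s = ℕ → Fin s → Digits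

-- numerator of the d-digit truncation: val B x d = Σ_{j<d} x j B^{d-1-j}
val : ℕ → Digits → ℕ → ℕ
val B x zero    = zero
val B x (suc d) = val B x d * B + x d

trunc : ℕ → Digits → Digits
trunc m x j = if j <ᵇ m then x j else zero

sumFin : ∀ {s} → (Fin s → ℕ) → ℕ
sumFin {zero}  f = zero
sumFin {suc s} f = f zero + sumFin (λ i → f (suc i))

lcmAll : ∀ {s} → (Fin s → ℕ) → ℕ
lcmAll {zero}  f = 1
lcmAll {suc s} f = lcm (f zero) (lcmAll (λ i → f (suc i)))

-- ⌈ u / g ⌉ for g ≥ 1
ceilDiv : ℕ → ℕ → ℕ
ceilDiv u g = (u + pred g) / suc (pred g)

-- a point p (as digit expansions) lies in the elementary interval
-- Π [a_i B^{-d_i}, (a_i+1) B^{-d_i})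
InElem : ∀ {s} → ℕ → (Fin s → Digits) → (d a : Fin s → ℕ) → Set
InElem B p d a = ∀ i → val B (p i) (d i) ≡ a i

-- number of n with k B^m ≤ n < (k+1) B^m such that [x_n]_{B,m} ∈ J(d,a)
countIn : ∀ {s} → ℕ → PointSeq s → (k m : ℕ) → (d a : Fin s → ℕ) → ℕ
countIn B x k m d a =
  length (filter (λ n → all? (λ i → val B (trunc m (x n i)) (d i) ≟ a i))
                 (map (λ r → k * B ^ m + r) (upTo (B ^ m))))

-- (u, e, s)-sequence in base B.  λ(J) = B^{-Σ d_i} ≥ B^{u-m}  ⇔  Σ d_i + u ≤ m,
-- and then B^m λ(J) = B^{m - Σ d_i}.
IsSeq : ∀ {s} → ℕ → ℕ → (Fin s → ℕ) → PointSeq s → Set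
IsSeq {s} B u e x =
  (∀ n i j → x n i j < B) ×
  (∀ (k m : ℕ) → u < m → (d a : Fin s → ℕ) →
     (∀ i → e i ∣ d i) → (∀ i → a i < B ^ d i) → sumFin d + u ≤ m →
     countIn B x k m d a ≡ B ^ (m ∸ sumFin d))

IsTSSeq : ∀ {s} → ℕ → ℕ → PointSeq s → Set
IsTSSeq B t x = IsSeq B t (λ _ → 1) x

-- base-B^g digit expansion of the same real: blocks of g base-B digits
regroup : ∀ {s} → ℕ → ℕ → PointSeq s → PointSeq s
regroup B g x n i j = val B (λ k → x n i (g * j + k)) g

module Submission where

-- Let g be any positive common multiple of e₁,…,e_s (in the theorem,
-- g = lcm e).  The base-b^g digits of a coordinate are the blocks of g
-- consecutive base-b digits ('regroup'), so its d-digit base-b^g prefix has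
-- the same value as its (g·d)-digit base-b prefix ('val-regroup').  Hence an
-- elementary interval in base b^g with exponents d_i is the base-b interval
-- with exponents g·d_i (which e_i divides), and the index window of length
-- (b^g)^m is the window of length b^(g·m).  So the base-b^g count with
-- m-digit truncation equals a base-b count with (g·m)-digit truncation
-- ('countIn-regroup').  For t = ⌈u/g⌉ we have u ≤ g·t, so t < m gives
-- u < g·m ('ceilDiv-<') and Σd_i + t ≤ m gives Σ(g·d_i) + u ≤ g·m
-- ('volume-scale'); the (u,e,s)-property then yields b^(g·m − g·Σd_i) =
-- (b^g)^(m − Σd_i) points.

open import Defs
open import Data.Nat using (ℕ; zero; suc; _+_; _*_; _∸_; _^_; _≤_; _<_; _<ᵇ_; s≤s; s≤s⁻¹; z≤n)
open import Data.Nat.Properties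
open import Data.Nat.DivMod using (_/_; _%_; m≡m%n+[m/n]*n; m%n<n)
open import Data.Nat.GCD using (gcd)
open import Data.Nat.LCM using (lcm; m∣lcm[m,n]; n∣lcm[m,n]; gcd*lcm)
open import Data.Nat.Divisibility using (_∣_; ∣-trans; ∣-refl; ∣m⇒∣m*n)
open import Data.Fin using (Fin; zero; suc)
open import Data.Fin.Properties using (all?)
open import Data.Bool using (true)
open import Data.List using (List; length; filter; map; upTo)
open import Data.List.Properties using (filter-≐)
open import Data.Product using (_,_)
open import Relation.Nullary using (Dec; contradiction)
open import Relation.Binary.PropositionalEquality

val-trunc : ∀ B x m D → D ≤ m → val B (trunc m x) D ≡ val B x D
val-trunc B x m zero    _    = refl
val-trunc B x m (suc D) D<m
  rewrite val-trunc B x m D (<⇒≤ D<m) with D <ᵇ m | <⇒<ᵇ D<m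
... | true | _ = refl

val-split : ∀ B x p q →
  val B x (p + q) ≡ val B x p * B ^ q + val B (λ k → x (p + k)) q
val-split B x p zero
  rewrite +-identityʳ p | *-identityʳ (val B x p) = sym (+-identityʳ _)
val-split B x p (suc q) rewrite +-suc p q | val-split B x p q = begin
  (V * B ^ q + W) * B + x (p + q)   ≡⟨ cong (_+ x (p + q)) (*-distribʳ-+ B (V * B ^ q) W) ⟩
  (V * B ^ q * B + W * B) + x (p + q) ≡⟨ +-assoc (V * B ^ q * B) (W * B) (x (p + q)) ⟩
  V * B ^ q * B + (W * B + x (p + q)) ≡⟨ cong (_+ (W * B + x (p + q))) (*-assoc V (B ^ q) B) ⟩
  V * (B ^ q * B) + (W * B + x (p + q)) ≡⟨ cong (λ z → V * z + (W * B + x (p + q))) (*-comm (B ^ q) B) ⟩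
  V * (B * B ^ q) + (W * B + x (p + q)) ∎
  where
  open ≡-Reasoning
  V W : ℕ
  V = val B x p
  W = val B (λ k → x (p + k)) q

val-regroup : ∀ b g (x : Digits) D →
  val (b ^ g) (λ j → val b (λ k → x (g * j + k)) g) D ≡ val b x (g * D)
val-regroup b g x zero rewrite *-zeroʳ g = refl
val-regroup b g x (suc D)
  rewrite val-regroup b g x D | *-suc g D | +-comm g (g * D) =
  sym (val-split b x (g * D) g)

val-< : ∀ B (x : Digits) → (∀ j → x j < B) → ∀ D → val B x D < B ^ D
val-< B x x<B zero    = s≤s z≤n
val-< B x x<B (suc D) = begin-strict
  val B x D * B + x D <⟨ +-monoʳ-< (val B x D * B) (x<B D) ⟩
  val B x D * B + B   ≡⟨ +-comm (val B x D * B) B ⟩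
  suc (val B x D) * B ≤⟨ *-monoˡ-≤ B (val-< B x x<B D) ⟩
  B ^ D * B           ≡⟨ *-comm (B ^ D) B ⟩
  B ^ suc D           ∎
  where open ≤-Reasoning

sumFin-* : ∀ {s} g (d : Fin s → ℕ) → sumFin (λ i → g * d i) ≡ g * sumFin d
sumFin-* {zero}  g d = sym (*-zeroʳ g)
sumFin-* {suc s} g d rewrite sumFin-* g (λ i → d (suc i)) =
  sym (*-distribˡ-+ g (d zero) _)

≤-sumFin : ∀ {s} (d : Fin s → ℕ) i → d i ≤ sumFin d
≤-sumFin d zero    = m≤m+n _ _
≤-sumFin d (suc i) = ≤-trans (≤-sumFin (λ j → d (suc j)) i) (m≤n+m _ (d zero))

∣-lcmAll : ∀ {s} (e : Fin s → ℕ) i → e i ∣ lcmAll e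
∣-lcmAll e zero    = m∣lcm[m,n] _ _
∣-lcmAll e (suc i) = ∣-trans (∣-lcmAll (λ j → e (suc j)) i) (n∣lcm[m,n] (e zero) _)

-- lcm of positive numbers is positive, since gcd m n * lcm m n = m * n.
lcm-pos : ∀ m n → 1 ≤ m → 1 ≤ n → 1 ≤ lcm m n
lcm-pos (suc a) (suc c) _ _ with lcm (suc a) (suc c) | gcd*lcm (suc a) (suc c)
... | zero  | eq = contradiction (trans (sym (*-zeroʳ (gcd (suc a) (suc c)))) eq) λ ()
... | suc _ | _  = s≤s z≤n

lcmAll-pos : ∀ {s} (e : Fin s → ℕ) → (∀ i → 1 ≤ e i) → 1 ≤ lcmAll e
lcmAll-pos {zero}  e e≥1 = ≤-refl
lcmAll-pos {suc s} e e≥1 =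
  lcm-pos (e zero) _ (e≥1 zero) (lcmAll-pos (λ i → e (suc i)) (λ i → e≥1 (suc i)))

ceilDiv-bound : ∀ u g → 1 ≤ g → u ≤ g * ceilDiv u g
ceilDiv-bound u (suc h) _ = +-cancelʳ-≤ h u (suc h * q) (begin
  u + h                ≡⟨ m≡m%n+[m/n]*n (u + h) (suc h) ⟩
  (u + h) % suc h + q * suc h ≤⟨ +-monoˡ-≤ (q * suc h) (s≤s⁻¹ (m%n<n (u + h) (suc h))) ⟩
  h + q * suc h        ≡⟨ +-comm h (q * suc h) ⟩
  q * suc h + h        ≡⟨ cong (_+ h) (*-comm q (suc h)) ⟩
  suc h * q + h        ∎)
  where
  open ≤-Reasoning
  q : ℕ
  q = (u + h) / suc h

ceilDiv-< : ∀ u g m → 1 ≤ g → ceilDiv u g < m → u < g * m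
ceilDiv-< u g m g≥1 t<m = begin-strict
  u                    ≤⟨ ceilDiv-bound u g g≥1 ⟩
  g * ceilDiv u g      <⟨ +-monoˡ-< (g * ceilDiv u g) g≥1 ⟩
  g + g * ceilDiv u g  ≡⟨ sym (*-suc g (ceilDiv u g)) ⟩
  g * suc (ceilDiv u g) ≤⟨ *-monoʳ-≤ g t<m ⟩
  g * m                ∎
  where open ≤-Reasoning

volume-scale : ∀ {s} u g m (d : Fin s → ℕ) → 1 ≤ g →
  sumFin d + ceilDiv u g ≤ m → sumFin (λ i → g * d i) + u ≤ g * m
volume-scale u g m d g≥1 volume = begin
  sumFin (λ i → g * d i) + u     ≡⟨ cong (_+ u) (sumFin-* g d) ⟩
  g * sumFin d + u               ≤⟨ +-monoʳ-≤ (g * sumFin d) (ceilDiv-bound u g g≥1) ⟩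
  g * sumFin d + g * ceilDiv u g ≡⟨ sym (*-distribˡ-+ g (sumFin d) (ceilDiv u g)) ⟩
  g * (sumFin d + ceilDiv u g)   ≤⟨ *-monoʳ-≤ g volume ⟩
  g * m                          ∎
  where open ≤-Reasoning

countIn-regroup : ∀ {s} b g (x : PointSeq s) k m (d a : Fin s → ℕ) →
  (∀ i → d i ≤ m) →
  countIn (b ^ g) (regroup b g x) k m d a ≡ countIn b x k (g * m) (λ i → g * d i) a
countIn-regroup b g x k m d a d≤m = begin
  length (filter inBox? (window ((b ^ g) ^ m))) ≡⟨ cong (λ N → length (filter inBox? (window N))) (^-*-assoc b g m) ⟩
  length (filter inBox? (window (b ^ (g * m)))) ≡⟨ cong length (filter-≐ inBox? inBox′? (to , from) (window (b ^ (g * m)))) ⟩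
  length (filter inBox′? (window (b ^ (g * m)))) ∎
  where
  open ≡-Reasoning
  window : ℕ → List ℕ
  window N = map (λ r → k * N + r) (upTo N)
  InBox InBox′ : ℕ → Set
  InBox n = ∀ i → val (b ^ g) (trunc m (regroup b g x n i)) (d i) ≡ a i
  InBox′ n = ∀ i → val b (trunc (g * m) (x n i)) (g * d i) ≡ a i
  inBox? : ∀ n → Dec (InBox n)
  inBox? n = all? (λ i → val (b ^ g) (trunc m (regroup b g x n i)) (d i) ≟ a i)
  inBox′? : ∀ n → Dec (InBox′ n)
  inBox′? n = all? (λ i → val b (trunc (g * m) (x n i)) (g * d i) ≟ a i)
  same-prefix : ∀ n i →
    val (b ^ g) (trunc m (regroup b g x n i)) (d i) ≡ val b (trunc (g * m) (x n i)) (g * d i)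
  same-prefix n i = begin
    val (b ^ g) (trunc m (regroup b g x n i)) (d i) ≡⟨ val-trunc (b ^ g) _ m (d i) (d≤m i) ⟩
    val (b ^ g) (regroup b g x n i) (d i)           ≡⟨ val-regroup b g (x n i) (d i) ⟩
    val b (x n i) (g * d i)                         ≡⟨ sym (val-trunc b (x n i) (g * m) (g * d i) (*-monoʳ-≤ g (d≤m i))) ⟩
    val b (trunc (g * m) (x n i)) (g * d i)         ∎
  to : ∀ {n} → InBox n → InBox′ n
  to {n} p i = trans (sym (same-prefix n i)) (p i)
  from : ∀ {n} → InBox′ n → InBox n
  from {n} p i = trans (same-prefix n i) (p i)

regroup-isTSSeq : ∀ {s} b u (e : Fin s → ℕ) g → 1 ≤ g → (∀ i → e i ∣ g) →
  (x : PointSeq s) → IsSeq b u e x → IsTSSeq (b ^ g) (ceilDiv u g) (regroup b g x)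
regroup-isTSSeq {s} b u e g g≥1 e∣g x (digits , count) = digits′ , count′
  where
  digits′ : ∀ n i j → regroup b g x n i j < b ^ g
  digits′ n i j = val-< b (λ k → x n i (g * j + k)) (λ k → digits n i (g * j + k)) g

  t : ℕ
  t = ceilDiv u g

  count′ : ∀ k m → t < m → (d a : Fin s → ℕ) → (∀ i → 1 ∣ d i) →
    (∀ i → a i < (b ^ g) ^ d i) → sumFin d + t ≤ m →
    countIn (b ^ g) (regroup b g x) k m d a ≡ (b ^ g) ^ (m ∸ sumFin d)
  count′ k m t<m d a _ a<B volume = begin
    countIn (b ^ g) (regroup b g x) k m d a    ≡⟨ countIn-regroup b g x k m d a d≤m ⟩
    countIn b x k (g * m) (λ i → g * d i) a    ≡⟨ count k (g * m) (ceilDiv-< u g m g≥1 t<m) (λ i → g * d i) a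
                                                     e∣gd a<b (volume-scale u g m d g≥1 volume) ⟩
    b ^ (g * m ∸ sumFin (λ i → g * d i))       ≡⟨ cong (λ z → b ^ (g * m ∸ z)) (sumFin-* g d) ⟩
    b ^ (g * m ∸ g * sumFin d)                 ≡⟨ cong (b ^_) (sym (*-distribˡ-∸ g m (sumFin d))) ⟩
    b ^ (g * (m ∸ sumFin d))                   ≡⟨ sym (^-*-assoc b g (m ∸ sumFin d)) ⟩
    (b ^ g) ^ (m ∸ sumFin d)                   ∎
    where
    open ≡-Reasoning
    d≤m : ∀ i → d i ≤ m
    d≤m i = ≤-trans (≤-sumFin d i) (≤-trans (m≤m+n (sumFin d) t) volume)
    e∣gd : ∀ i → e i ∣ g * d i
    e∣gd i = ∣-trans (e∣g i) (∣m⇒∣m*n (d i) ∣-refl)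
    a<b : ∀ i → a i < b ^ (g * d i)
    a<b i = subst (a i <_) (^-*-assoc b g (d i)) (a<B i)

theorem4 : (b s u : ℕ) (e : Fin s → ℕ) → 2 ≤ b → 1 ≤ s → (∀ i → 1 ≤ e i) →
    (x : PointSeq s) → IsSeq b u e x →
    IsTSSeq (b ^ lcmAll e) (ceilDiv u (lcmAll e)) (regroup b (lcmAll e) x)
theorem4 b s u e _ _ e≥1 x isSeq =
  regroup-isTSSeq b u e (lcmAll e) (lcmAll-pos e e≥1) (∣-lcmAll e) x isSeq
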